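{- Let $n\ge1$, let $\pi$ be a link pattern on $\{1,\dots,2n\}$ and $\mathbf{w}$ a $01$-word of length $2n$ with $C^{\operatorname{ext}}(n)_{\mathbf{w},\pi}\neq0$. Let $1\le i<j\le 2n$ be such that $\pi$ induces a link pattern $\pi'$ on $\{i,i+1,\dots,j\}$. Then: (1) the subword $\mathbf{w}[i,j]$ contains at least as many $0$'s as $1$'s; (2) if $d\ge0$ is the number of $0$'s minus the number of $1$'s in $\mathbf{w}[i,j]$, then the path $\operatorname{path}(\mathbf{w}[i,j])$ shifted $d$ unit steps downwards lies (weakly) below the path $\operatorname{path}(\pi')$.
   Context: A link pattern on a finite interval of integers $\{a,\dots,b\}$ is a non-crossing perfect matching of it; its elements are arcs. A link pattern $\pi$ on $\{1,\dots,2n\}$ induces a link pattern on $\{i,\dots,j\}$ if every element of $\{i,\dots,j\}$ is matched by $\pi$ to an element of $\{i,\dots,j\}$; the restriction is $\pi'$. For a word $\mathbf{w}$, $\mathbf{w}[i,j]$ is the subword of letters in positions $i,\dots,j$. For a $01$-word $\mathbf{u}$, $\operatorname{path}(\mathbf{u})$ is the lattice path starting at the origin in which each $0$ is a $(1,1)$-step and each $1$ a $(1,-1)$-step. For a link pattern $\pi'$ on $\{i,\dots,j\}$, its Dyck word has letter $0$ at position $k$ if $k$ is the smaller endpoint of its arc and $1$ otherwise, and $\operatorname{path}(\pi')$ is the path of this Dyck word. For a link pattern $\pi$ on $\{1,\dots,2n\}$ and a $01$-word $\mathbf{w}$ of length $2n$: for an arc connecting $a<b$, let $n_0,n_1$ be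 the numbers of $0$'s and $1$'s in $\mathbf{w}[a,b-1]$; the arc is contradicting if $n_0-n_1\equiv -1 \pmod 3$ and negative if $n_0-n_1\equiv 0\pmod 3$. Then $C^{\operatorname{ext}}(n)_{\mathbf{w},\pi}=0$ if $\pi$ has a contradicting arc, and $(-1)^{\#\text{negative arcs}}$ otherwise. -}

module Defs where

open import Data.Nat using (ℕ; _<_; _≤_; _+_; _≤?_; _<?_; suc)
open import Data.Fin using (Fin; toℕ)
open import Data.List using (List; filter; map; length)
open import Data.Bool.ListAction using (any)
open import Data.List.Base using (foldr)
open import Data.Fin.Base using ()
open import Data.Fin.Properties using ()
open import Data.List using (allFin)
open import Data.Integer using (ℤ; +_; -_; _-_; 0ℤ; 1ℤ; -1ℤ; _*_) renaming (_+_ to _+ℤ_)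
open import Data.Integer.DivMod using (_%ℕ_)
open import Data.Bool using (Bool; true; false; if_then_else_)
open import Data.Product using (_×_)
open import Relation.Binary.PropositionalEquality using (_≡_; _≢_)
open import Relation.Nullary using (¬_; yes; no)
open import Data.Empty using (⊥)
open import Data.Bool.Properties using () renaming (_≟_ to _≡?_)
open import Relation.Nullary.Decidable using (_×-dec_; ⌊_⌋)
import Data.Nat as ℕ

-- Positions 1..N of the paper are represented by Fin N, position p ↦ index p-1.

data Letter : Set where
  𝟘 𝟙 : Letter

Word : ℕ → Set
Word N = Fin N → Letter

record LinkPattern (N : ℕ) : Set where
  field
    partner      : Fin N → Fin N
    involutive   : ∀ k → partner (partner k) ≡ k
    no-fixpoint  : ∀ k → partner k ≢ k
    non-crossing : ∀ a b → toℕ a < toℕ b → toℕ b < toℕ (partner a) →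
                   toℕ (partner a) < toℕ (partner b) → ⊥
open LinkPattern public

segSum : {N : ℕ} → (Fin N → ℤ) → ℕ → ℕ → ℤ
segSum {N} g lo hi =
  foldr _+ℤ_ 0ℤ (map g (filter (λ k → (lo ≤? toℕ k) ×-dec (toℕ k <? hi)) (allFin N)))

is0 : Letter → ℤ
is0 𝟘 = 1ℤ
is0 𝟙 = 0ℤ

is1 : Letter → ℤ
is1 𝟘 = 0ℤ
is1 𝟙 = 1ℤ

count0 count1 : {N : ℕ} → Word N → ℕ → ℕ → ℤ
count0 w lo hi = segSum (λ k → is0 (w k)) lo hi
count1 w lo hi = segSum (λ k → is1 (w k)) lo hi

-- arcs: the pairs (a , m a) with a < m a, listed by their left endpoint
arcStarts : {N : ℕ} → LinkPattern N → List (Fin N)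
arcStarts {N} π = filter (λ a → toℕ a <? toℕ (partner π a)) (allFin N)

arcExcess : {N : ℕ} → LinkPattern N → Word N → Fin N → ℤ
arcExcess π w a = count0 w (toℕ a) (toℕ (partner π a)) - count1 w (toℕ a) (toℕ (partner π a))

contradicting : {N : ℕ} → LinkPattern N → Word N → Fin N → Bool
contradicting π w a = ⌊ (arcExcess π w a %ℕ 3) ℕ.≟ 2 ⌋   -- ≡ -1 (mod 3)

negative : {N : ℕ} → LinkPattern N → Word N → Fin N → Bool
negative π w a = ⌊ (arcExcess π w a %ℕ 3) ℕ.≟ 0 ⌋

Cext : (n : ℕ) → Word (2 ℕ.* n) → LinkPattern (2 ℕ.* n) → ℤ
Cext n w π =
  if any (contradicting π w) (arcStarts π) then 0ℤ
  else foldr _*_ 1ℤ (map (λ _ → -1ℤ) (filter (λ a → negative π w a ≡? true) (arcStarts π)))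

Induces : {N : ℕ} → LinkPattern N → Fin N → Fin N → Set
Induces π i j = ∀ k → toℕ i ≤ toℕ k → toℕ k ≤ toℕ j →
                  (toℕ i ≤ toℕ (partner π k)) × (toℕ (partner π k) ≤ toℕ j)

wordHeight : {N : ℕ} → Word N → Fin N → ℕ → ℤ
wordHeight w i t = count0 w (toℕ i) (toℕ i + t) - count1 w (toℕ i) (toℕ i + t)

dyckLetter : {N : ℕ} → LinkPattern N → Fin N → Letter
dyckLetter π k with toℕ k <? toℕ (partner π k)
... | yes _ = 𝟘
... | no _  = 𝟙

-- height after t steps of path(π'), π' the restriction to {i,…}
linkHeight : {N : ℕ} → LinkPattern N → Fin N → ℕ → ℤ
linkHeight π i t = wordHeight (dyckLetter π) i t

-- Call [x, y) closed when π maps it to itself. A nonempty closed interval starts with an arc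
-- (a, a′), whose interior and whose complement [a′+1, y) are again closed. Induction along this
-- decomposition shows that the excess of w over a closed interval is even and non-negative: over
-- the arc [a, a′) it is step(w a) plus an even non-negative number, hence odd and at least -1,
-- and -1 would make the arc contradicting. The Dyck word of π has excess 0 on closed intervals.
-- For the path comparison, read a suffix of a closed interval from the right: each arc adds 0 to
-- the Dyck path and at least 0 to path(w), each closing position adds -1 to the Dyck path and at
-- least -1 to path(w); so suffixes of w dominate those of π, which is the shifted-path bound.
module Submission where

open import Defs
open import Data.Nat using (ℕ; _≤_; _<_; _∸_; _+_; _*_; _≤?_; _<?_; suc; zero; z≤n; s≤s)
import Data.Nat.Properties as ℕP
open import Data.Nat.Induction using (<-wellFounded)
open import Induction.WellFounded using (Acc; acc)
open import Data.Fin using (Fin; toℕ; fromℕ<)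
import Data.Fin as Fin
import Data.Fin.Properties as FP
open import Data.List using (map; filter; foldr; tabulate)
open import Data.List.Membership.Propositional using (lose)
open import Data.List.Membership.Propositional.Properties using (∈-filter⁺; ∈-allFin)
open import Data.List.Relation.Unary.Any.Properties using (any⁺)
open import Data.Bool using (true; false; if_then_else_)
open import Data.Bool.Properties using (T-≡)
open import Data.Integer using (ℤ; +_; -_; 0ℤ; 1ℤ; -1ℤ; _-_; +≤+; -≤+) 
  renaming (_+_ to _+ℤ_; _≤_ to _≤ℤ_)
import Data.Integer.Properties as ℤP
open import Data.Integer.DivMod using (_%ℕ_)
open import Data.Integer.Solver using (module +-*-Solver)
open import Algebra.Properties.CommutativeMonoid.Sum ℤP.+-0-commutativeMonoid
  using (sum; sum-cong-≗; sum-replicate-zero; sum-remove; ∑-distrib-+)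
open import Data.Product using (_×_; _,_; proj₁; proj₂; ∃-syntax)
open import Data.Sum using (inj₁; inj₂)
open import Data.Empty using (⊥-elim)
open import Function using (Equivalence; _⇔_; mk⇔)
open import Relation.Binary using (tri<; tri≈; tri>)
open import Relation.Binary.PropositionalEquality
open import Relation.Nullary using (Dec; yes; no; does; ¬_) 
open import Relation.Nullary.Decidable using (_×-dec_; dec-true; dec-false; does-⇔; fromWitness)
open import Relation.Unary using (Pred; Decidable)
open +-*-Solver

-- Segment sums

inRange? : ∀ lo hi m → Dec (lo ≤ m × m < hi)
inRange? lo hi m = (lo ≤? m) ×-dec (m <? hi)

restrict : ∀ {N} → ℕ → ℕ → (Fin N → ℤ) → Fin N → ℤ
restrict lo hi g k = if does (inRange? lo hi (toℕ k)) then g k else 0ℤ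

sum-filter-tabulate : ∀ {A : Set} {ℓ} {P : Pred A ℓ} (P? : Decidable P) (g : A → ℤ) {n}
  (f : Fin n → A) →
  foldr _+ℤ_ 0ℤ (map g (filter P? (tabulate f)))
    ≡ sum (λ k → if does (P? (f k)) then g (f k) else 0ℤ)
sum-filter-tabulate P? g {zero} f = refl
sum-filter-tabulate P? g {suc n} f with does (P? (f Fin.zero))
... | true  = cong (g (f Fin.zero) +ℤ_) (sum-filter-tabulate P? g (λ k → f (Fin.suc k)))
... | false = trans (sum-filter-tabulate P? g (λ k → f (Fin.suc k))) (sym (ℤP.+-identityˡ _))

segSum≡sum-restrict : ∀ {N} (g : Fin N → ℤ) lo hi → segSum g lo hi ≡ sum (restrict lo hi g)
segSum≡sum-restrict g lo hi = sum-filter-tabulate (λ k → inRange? lo hi (toℕ k)) g (λ k → k)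

module _ {N : ℕ} (g : Fin N → ℤ) where

  restrict-inside : ∀ {lo hi} k → lo ≤ toℕ k × toℕ k < hi → restrict lo hi g k ≡ g k
  restrict-inside {lo} {hi} k inside rewrite dec-true (inRange? lo hi (toℕ k)) inside = refl

  restrict-outside : ∀ {lo hi} k → ¬ (lo ≤ toℕ k × toℕ k < hi) → restrict lo hi g k ≡ 0ℤ
  restrict-outside {lo} {hi} k outside rewrite dec-false (inRange? lo hi (toℕ k)) outside = refl

  restrict-cong : ∀ {lo hi lo′ hi′} k →
                  (lo ≤ toℕ k × toℕ k < hi) ⇔ (lo′ ≤ toℕ k × toℕ k < hi′) →
                  restrict lo hi g k ≡ restrict lo′ hi′ g k
  restrict-cong {lo} {hi} {lo′} {hi′} k same =
    cong (λ b → if b then g k else 0ℤ) (does-⇔ same (inRange? lo hi (toℕ k)) (inRange? lo′ hi′ (toℕ k)))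

  restrict-split : ∀ {x y z} → x ≤ y → y ≤ z → ∀ k →
                   restrict x z g k ≡ restrict x y g k +ℤ restrict y z g k
  restrict-split {x} {y} {z} x≤y y≤z k with toℕ k <? y
  ... | yes k<y = begin
    restrict x z g k
      ≡⟨ restrict-cong {x} {z} {x} {y} k (mk⇔ (λ (x≤k , _) → x≤k , k<y)
                                              (λ (x≤k , _) → x≤k , ℕP.<-≤-trans k<y y≤z)) ⟩
    restrict x y g k
      ≡⟨ ℤP.+-identityʳ _ ⟨
    restrict x y g k +ℤ 0ℤ
      ≡⟨ cong (restrict x y g k +ℤ_) (restrict-outside {y} {z} k λ (y≤k , _) → ℕP.<⇒≱ k<y y≤k) ⟨
    restrict x y g k +ℤ restrict y z g k ∎
    where open ≡-Reasoning
  ... | no k≮y = begin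
    restrict x z g k
      ≡⟨ restrict-cong {x} {z} {y} {z} k (mk⇔ (λ (_ , k<z) → ℕP.≮⇒≥ k≮y , k<z)
                                              (λ (y≤k , k<z) → ℕP.≤-trans x≤y y≤k , k<z)) ⟩
    restrict y z g k
      ≡⟨ ℤP.+-identityˡ _ ⟨
    0ℤ +ℤ restrict y z g k
      ≡⟨ cong (_+ℤ restrict y z g k) (restrict-outside {x} {y} k λ (_ , k<y) → k≮y k<y) ⟨
    restrict x y g k +ℤ restrict y z g k ∎
    where open ≡-Reasoning

  segSum-empty : ∀ x → segSum g x x ≡ 0ℤ
  segSum-empty x = begin
    segSum g x x
      ≡⟨ segSum≡sum-restrict g x x ⟩
    sum (restrict x x g)
      ≡⟨ sum-cong-≗ (λ k → restrict-outside {x} {x} k λ (x≤k , k<x) → ℕP.<⇒≱ k<x x≤k) ⟩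
    sum {N} (λ _ → 0ℤ)
      ≡⟨ sum-replicate-zero N ⟩
    0ℤ ∎
    where open ≡-Reasoning

  segSum-split : ∀ {x y z} → x ≤ y → y ≤ z → segSum g x z ≡ segSum g x y +ℤ segSum g y z
  segSum-split {x} {y} {z} x≤y y≤z = begin
    segSum g x z
      ≡⟨ segSum≡sum-restrict g x z ⟩
    sum (restrict x z g)
      ≡⟨ sum-cong-≗ (restrict-split x≤y y≤z) ⟩
    sum (λ k → restrict x y g k +ℤ restrict y z g k)
      ≡⟨ ∑-distrib-+ (restrict x y g) (restrict y z g) ⟩
    sum (restrict x y g) +ℤ sum (restrict y z g)
      ≡⟨ cong₂ _+ℤ_ (segSum≡sum-restrict g x y) (segSum≡sum-restrict g y z) ⟨
    segSum g x y +ℤ segSum g y z ∎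
    where open ≡-Reasoning

segSum-singleton : ∀ {N} (g : Fin N → ℤ) (a : Fin N) → segSum g (toℕ a) (suc (toℕ a)) ≡ g a
segSum-singleton {suc N} g a = begin
  segSum g (toℕ a) (suc (toℕ a))
    ≡⟨ segSum≡sum-restrict g (toℕ a) (suc (toℕ a)) ⟩
  sum [a]
    ≡⟨ sum-remove {i = a} [a] ⟩
  [a] a +ℤ sum (λ k → [a] (Fin.punchIn a k))
    ≡⟨ cong₂ _+ℤ_ (restrict-inside g {toℕ a} {suc (toℕ a)} a (ℕP.≤-refl , ℕP.n<1+n _))
                  (trans (sum-cong-≗ {N} off) (sum-replicate-zero N)) ⟩
  g a +ℤ 0ℤ
    ≡⟨ ℤP.+-identityʳ (g a) ⟩
  g a ∎
  where
  open ≡-Reasoning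
  [a] = restrict (toℕ a) (suc (toℕ a)) g
  off : ∀ k → [a] (Fin.punchIn a k) ≡ 0ℤ
  off k = restrict-outside g {toℕ a} {suc (toℕ a)} _ λ (a≤k , k<1+a) →
    FP.punchInᵢ≢i a k (FP.toℕ-injective (ℕP.≤-antisym (ℕP.≤-pred k<1+a) a≤k))

-- Excess of 0's over 1's

step : Letter → ℤ
step 𝟘 = 1ℤ
step 𝟙 = -1ℤ

-- wordHeight, linkHeight and arcExcess are all instances of excess, definitionally.
excess : ∀ {N} → Word N → ℕ → ℕ → ℤ
excess u x y = count0 u x y - count1 u x y

module _ {N : ℕ} (u : Word N) where

  private
    #0 #1 : Fin N → ℤ
    #0 k = is0 (u k)
    #1 k = is1 (u k)

  excess-empty : ∀ x → excess u x x ≡ 0ℤ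
  excess-empty x rewrite segSum-empty #0 x | segSum-empty #1 x = refl

  excess-split : ∀ {x y z} → x ≤ y → y ≤ z → excess u x z ≡ excess u x y +ℤ excess u y z
  excess-split {x} {y} {z} x≤y y≤z
    rewrite segSum-split #0 x≤y y≤z | segSum-split #1 x≤y y≤z =
    solve 4 (λ a b c d → (a :+ b) :- (c :+ d) := (a :- c) :+ (b :- d)) refl
      (count0 u x y) (count0 u y z) (count1 u x y) (count1 u y z)

  excess-singleton : ∀ a → excess u (toℕ a) (suc (toℕ a)) ≡ step (u a)
  excess-singleton a rewrite segSum-singleton #0 a | segSum-singleton #1 a with u a
  ... | 𝟘 = refl
  ... | 𝟙 = refl

  excess-uncons : ∀ a {y} → toℕ a < y → excess u (toℕ a) y ≡ step (u a) +ℤ excess u (suc (toℕ a)) y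
  excess-uncons a a<y = trans (excess-split (ℕP.n≤1+n _) a<y)
                              (cong (_+ℤ excess u (suc (toℕ a)) _) (excess-singleton a))

  excess-around : ∀ a b {y} → toℕ a < toℕ b → toℕ b < y →
    excess u (toℕ a) y ≡ (step (u a) +ℤ excess u (suc (toℕ a)) (toℕ b))
                         +ℤ (step (u b) +ℤ excess u (suc (toℕ b)) y)
  excess-around a b a<b b<y = trans (excess-split (ℕP.<⇒≤ a<b) (ℕP.<⇒≤ b<y))
                                    (cong₂ _+ℤ_ (excess-uncons a a<b) (excess-uncons b b<y))

shorter : ∀ {x x′ y y′} → x < x′ → x′ ≤ y → y′ ≤ y → y′ ∸ x′ < y ∸ x
shorter {x′ = x′} x<x′ x′≤y y′≤y = ℕP.≤-<-trans (ℕP.∸-monoˡ-≤ x′ y′≤y) (ℕP.∸-monoʳ-< x<x′ x′≤y)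

NonNegEven : ℤ → Set
NonNegEven e = ∃[ m ] e ≡ + m +ℤ + m

arc-excess-odd : ∀ l m → (step l +ℤ (+ m +ℤ + m)) %ℕ 3 ≢ 2 →
                 ∃[ k ] step l +ℤ (+ m +ℤ + m) ≡ 1ℤ +ℤ (+ k +ℤ + k)
arc-excess-odd 𝟘 m       _      = m , refl
arc-excess-odd 𝟙 zero    contra = ⊥-elim (contra refl)
arc-excess-odd 𝟙 (suc m) _      = m , cong +_ (ℕP.+-suc m m)

odd+step+even : ∀ k l m → NonNegEven ((1ℤ +ℤ (+ k +ℤ + k)) +ℤ (step l +ℤ (+ m +ℤ + m)))
odd+step+even k 𝟘 m = suc (k + m) , trans
  (solve 2 (λ k m → (con 1ℤ :+ (k :+ k)) :+ (con 1ℤ :+ (m :+ m))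
                    := (con 1ℤ :+ (k :+ m)) :+ (con 1ℤ :+ (k :+ m))) refl (+ k) (+ m))
  (sym (cong₂ _+ℤ_ (cong (1ℤ +ℤ_) (ℤP.pos-+ k m)) (cong (1ℤ +ℤ_) (ℤP.pos-+ k m))))
odd+step+even k 𝟙 m = k + m , trans
  (solve 2 (λ k m → (con 1ℤ :+ (k :+ k)) :+ (con -1ℤ :+ (m :+ m)) := (k :+ m) :+ (k :+ m)) refl (+ k) (+ m))
  (sym (cong₂ _+ℤ_ (ℤP.pos-+ k m) (ℤP.pos-+ k m)))

step-≥-1 : ∀ l → -1ℤ ≤ℤ step l
step-≥-1 𝟘 = -≤+
step-≥-1 𝟙 = ℤP.≤-refl

-- Link patterns

module _ {N : ℕ} (π : LinkPattern N) where

  mate : Fin N → ℕ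
  mate k = toℕ (partner π k)

  dyck : Word N
  dyck = dyckLetter π

  mate-partner : ∀ k → mate (partner π k) ≡ toℕ k
  mate-partner k = cong toℕ (involutive π k)

  mate-injective : ∀ {a b} → mate a ≡ mate b → a ≡ b
  mate-injective {a} {b} eq =
    trans (sym (involutive π a)) (trans (cong (partner π) (FP.toℕ-injective eq)) (involutive π b))

  mate-swap : ∀ {k s} → mate k ≡ toℕ s → toℕ k ≡ mate s
  mate-swap {k} eq = trans (sym (mate-partner k)) (cong mate (FP.toℕ-injective eq))

  nested : ∀ {s k} → toℕ s < toℕ k → toℕ k < mate s → toℕ s < mate k × mate k < mate s
  nested {s} {k} s<k k<s′ with ℕP.<-cmp (mate k) (toℕ s)
  ... | tri< k′<s _ _ = ⊥-elim (non-crossing π (partner π k) s k′<s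
                          (subst (toℕ s <_) (sym (mate-partner k)) s<k)
                          (subst (_< mate s) (sym (mate-partner k)) k<s′))
  ... | tri≈ _ k′≡s _ = ⊥-elim (ℕP.<-irrefl (mate-swap k′≡s) k<s′)
  ... | tri> _ _ s<k′ with ℕP.<-cmp (mate k) (mate s)
  ...   | tri< k′<s′ _ _ = s<k′ , k′<s′
  ...   | tri≈ _ k′≡s′ _ = ⊥-elim (ℕP.<-irrefl (cong toℕ (sym (mate-injective k′≡s′))) s<k)
  ...   | tri> _ _ s′<k′ = ⊥-elim (non-crossing π s k s<k k<s′ s′<k′)

  Closed : ℕ → ℕ → Set
  Closed x y = ∀ k → x ≤ toℕ k → toℕ k < y → x ≤ mate k × mate k < y

  induces⇒closed : ∀ {i j} → Induces π i j → Closed (toℕ i) (toℕ j + 1)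
  induces⇒closed {i} {j} induces k i≤k k<j+1 =
    let i≤k′ , k′≤j = induces k i≤k (ℕP.≤-pred (subst (toℕ k <_) (ℕP.+-comm (toℕ j) 1) k<j+1))
    in i≤k′ , subst (mate k <_) (ℕP.+-comm 1 (toℕ j)) (s≤s k′≤j)

  closed-head-opens : ∀ {a y} → Closed (toℕ a) y → toℕ a < y → toℕ a < mate a
  closed-head-opens {a} closed a<y = ℕP.≤∧≢⇒< (proj₁ (closed a ℕP.≤-refl a<y))
                                              (λ eq → no-fixpoint π a (FP.toℕ-injective (sym eq)))

  closed-inside : ∀ a → Closed (suc (toℕ a)) (mate a)
  closed-inside a k = nested

  closed-after : ∀ {a y} → Closed (toℕ a) y → toℕ a < mate a → Closed (suc (mate a)) y
  closed-after {a} closed a<a′ k a′<k k<y = a′<k′ , proj₂ (closed k a≤k k<y)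
    where
    a≤k = ℕP.<⇒≤ (ℕP.<-trans a<a′ a′<k)
    a′<k′ : mate a < mate k
    a′<k′ with ℕP.<-cmp (mate a) (mate k) | ℕP.m≤n⇒m<n∨m≡n (proj₁ (closed k a≤k k<y))
    ... | tri< a′<k′ _ _ | _       = a′<k′
    ... | tri≈ _ a′≡k′ _ | _       = ⊥-elim (ℕP.<-irrefl (cong toℕ (mate-injective a′≡k′))
                                                         (ℕP.<-trans a<a′ a′<k))
    ... | tri> _ _ k′<a′ | inj₂ a≡k′ = ⊥-elim (ℕP.<-irrefl (sym (mate-swap (sym a≡k′))) a′<k)
    ... | tri> _ _ k′<a′ | inj₁ a<k′ =
      ⊥-elim (ℕP.<-asym a′<k (subst (_< mate a) (mate-partner k) (proj₂ (nested a<k′ k′<a′))))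

  closed-arc : ∀ {a} → toℕ a < mate a → Closed (toℕ a) (suc (mate a))
  closed-arc {a} a<a′ k a≤k k≤a′ with ℕP.m≤n⇒m<n∨m≡n a≤k | ℕP.m≤n⇒m<n∨m≡n (ℕP.≤-pred k≤a′)
  ... | inj₂ a≡k | _ rewrite FP.toℕ-injective a≡k = ℕP.<⇒≤ a<a′ , ℕP.n<1+n _
  ... | inj₁ _ | inj₂ k≡a′ = ℕP.≤-reflexive (mate-swap (sym k≡a′)) ,
                             ℕP.<-trans (subst (_< mate a) (mate-swap (sym k≡a′)) a<a′) (ℕP.n<1+n _)
  ... | inj₁ a<k | inj₁ k<a′ = let a<k′ , k′<a′ = nested a<k k<a′ in
                               ℕP.<⇒≤ a<k′ , ℕP.<-trans k′<a′ (ℕP.n<1+n _)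

  module _ (Q : ℕ → ℕ → Set) (Q-empty : ∀ x → Q x x)
           (Q-arc : ∀ a {y} → toℕ a < mate a → mate a < y →
                    Q (suc (toℕ a)) (mate a) → Q (suc (mate a)) y → Q (toℕ a) y) where

    closed-ind : ∀ {x y} → x ≤ y → y ≤ N → Closed x y → Q x y
    closed-ind x≤y y≤N closed = go x≤y y≤N closed (<-wellFounded _)
      where
      go : ∀ {x y} → x ≤ y → y ≤ N → Closed x y → Acc _<_ (y ∸ x) → Q x y
      go {x} {y} x≤y y≤N closed (acc recurse) with x <? y
      ... | no x≮y = subst (Q x) (ℕP.≤-antisym x≤y (ℕP.≮⇒≥ x≮y)) (Q-empty x)
      ... | yes x<y with fromℕ< (ℕP.<-≤-trans x<y y≤N) | FP.toℕ-fromℕ< (ℕP.<-≤-trans x<y y≤N)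
      ...   | a | refl = Q-arc a a<a′ a′<y
        (go a<a′ (ℕP.<⇒≤ (FP.toℕ<n (partner π a))) (closed-inside a)
            (recurse (shorter (ℕP.n<1+n _) x<y (ℕP.<⇒≤ a′<y))))
        (go a′<y y≤N (closed-after closed a<a′)
            (recurse (shorter (ℕP.<-trans a<a′ (ℕP.n<1+n _)) a′<y ℕP.≤-refl)))
        where
        a<a′ = closed-head-opens closed x<y
        a′<y = proj₂ (closed a ℕP.≤-refl x<y)

  dyck-opening : ∀ k → toℕ k < mate k → dyck k ≡ 𝟘
  dyck-opening k k<k′ with toℕ k <? mate k
  ... | yes _   = refl
  ... | no k≮k′ = ⊥-elim (k≮k′ k<k′)

  dyck-closing : ∀ k → ¬ toℕ k < mate k → dyck k ≡ 𝟙
  dyck-closing k k≮k′ with toℕ k <? mate k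
  ... | yes k<k′ = ⊥-elim (k≮k′ k<k′)
  ... | no _     = refl

  partner-closes : ∀ {a} → toℕ a < mate a → ¬ mate a < mate (partner π a)
  partner-closes {a} a<a′ a′<a = ℕP.<-asym a<a′ (subst (mate a <_) (mate-partner a) a′<a)

  dyck-balanced : ∀ {x y} → x ≤ y → y ≤ N → Closed x y → excess dyck x y ≡ 0ℤ
  dyck-balanced = closed-ind (λ x y → excess dyck x y ≡ 0ℤ) (excess-empty (dyck)) arc
    where
    arc : ∀ a {y} → toℕ a < mate a → mate a < y →
          excess dyck (suc (toℕ a)) (mate a) ≡ 0ℤ →
          excess dyck (suc (mate a)) y ≡ 0ℤ → excess dyck (toℕ a) y ≡ 0ℤ
    arc a {y} a<a′ a′<y inside after = begin
      excess dyck (toℕ a) y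
        ≡⟨ excess-around (dyck) a (partner π a) a<a′ a′<y ⟩
      (step (dyck a) +ℤ excess dyck (suc (toℕ a)) (mate a))
        +ℤ (step (dyck (partner π a)) +ℤ excess dyck (suc (mate a)) y)
        ≡⟨ cong₂ _+ℤ_ (cong₂ _+ℤ_ (cong step (dyck-opening a a<a′)) inside)
                      (cong₂ _+ℤ_ (cong step (dyck-closing (partner π a) (partner-closes a<a′))) after) ⟩
      0ℤ ∎
      where open ≡-Reasoning

  module _ (w : Word N) (no-contradicting : ∀ a → toℕ a < mate a → arcExcess π w a %ℕ 3 ≢ 2) where

    word-balanced : ∀ {x y} → x ≤ y → y ≤ N → Closed x y → NonNegEven (excess w x y)
    word-balanced = closed-ind (λ x y → NonNegEven (excess w x y)) (λ x → 0 , excess-empty w x) arc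
      where
      arc : ∀ a {y} → toℕ a < mate a → mate a < y →
            NonNegEven (excess w (suc (toℕ a)) (mate a)) →
            NonNegEven (excess w (suc (mate a)) y) → NonNegEven (excess w (toℕ a) y)
      arc a {y} a<a′ a′<y (m₁ , inside) (m₂ , after) =
        let k , odd  = arc-excess-odd (w a) m₁
                         (subst (λ e → e %ℕ 3 ≢ 2) arc-excess (no-contradicting a a<a′))
            n , even = odd+step+even k (w (partner π a)) m₂
        in n , (begin
        excess w (toℕ a) y
          ≡⟨ excess-around w a (partner π a) a<a′ a′<y ⟩
        (step (w a) +ℤ excess w (suc (toℕ a)) (mate a)) +ℤ (step (w (partner π a)) +ℤ excess w (suc (mate a)) y)
          ≡⟨ cong₂ _+ℤ_ (trans (cong (step (w a) +ℤ_) inside) odd) (cong (step (w (partner π a)) +ℤ_) after) ⟩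
        (1ℤ +ℤ (+ k +ℤ + k)) +ℤ (step (w (partner π a)) +ℤ (+ m₂ +ℤ + m₂))
          ≡⟨ even ⟩
        + n +ℤ + n ∎)
        where
        open ≡-Reasoning
        arc-excess : arcExcess π w a ≡ step (w a) +ℤ (+ m₁ +ℤ + m₁)
        arc-excess = trans (excess-uncons w a a<a′) (cong (step (w a) +ℤ_) inside)

    suffix-dominated : ∀ {x y s} → Closed x y → y ≤ N → x ≤ s → s ≤ y →
                       excess dyck s y ≤ℤ excess w s y
    suffix-dominated {x} {y} {s} closed y≤N x≤s s≤y = go x≤s s≤y (<-wellFounded _)
      where
      go : ∀ {s} → x ≤ s → s ≤ y → Acc _<_ (y ∸ s) → excess dyck s y ≤ℤ excess w s y
      go {s} x≤s s≤y (acc recurse) with s <? y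
      ... | no s≮y rewrite ℕP.≤-antisym s≤y (ℕP.≮⇒≥ s≮y) =
        ℤP.≤-reflexive (trans (excess-empty (dyck) y) (sym (excess-empty w y)))
      ... | yes s<y with fromℕ< (ℕP.<-≤-trans s<y y≤N) | FP.toℕ-fromℕ< (ℕP.<-≤-trans s<y y≤N)
      ...   | a | refl with toℕ a <? mate a
      ...     | yes a<a′ = let m , balanced = word-balanced a≤1+a′ a′<N (closed-arc a<a′) in begin
        excess dyck (toℕ a) y
          ≡⟨ excess-split (dyck) a≤1+a′ a′<y ⟩
        excess dyck (toℕ a) (suc (mate a)) +ℤ excess dyck (suc (mate a)) y
          ≡⟨ cong (_+ℤ excess dyck (suc (mate a)) y) (dyck-balanced a≤1+a′ a′<N (closed-arc a<a′)) ⟩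
        0ℤ +ℤ excess dyck (suc (mate a)) y
          ≤⟨ ℤP.+-mono-≤ (+≤+ z≤n) (go (ℕP.≤-trans x≤s a≤1+a′) a′<y
                                        (recurse (ℕP.∸-monoʳ-< (ℕP.m<n⇒m<1+n a<a′) a′<y))) ⟩
        (+ m +ℤ + m) +ℤ excess w (suc (mate a)) y
          ≡⟨ cong (_+ℤ excess w (suc (mate a)) y) balanced ⟨
        excess w (toℕ a) (suc (mate a)) +ℤ excess w (suc (mate a)) y
          ≡⟨ excess-split w a≤1+a′ a′<y ⟨
        excess w (toℕ a) y ∎
        where
        open ℤP.≤-Reasoning
        a≤1+a′ = ℕP.m<n⇒m≤1+n a<a′
        a′<y = proj₂ (closed a x≤s s<y)
        a′<N = FP.toℕ<n (partner π a)
      ...     | no a≮a′ = begin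
        excess dyck (toℕ a) y
          ≡⟨ excess-uncons (dyck) a s<y ⟩
        step (dyck a) +ℤ excess dyck (suc (toℕ a)) y
          ≡⟨ cong (λ l → step l +ℤ excess dyck (suc (toℕ a)) y) (dyck-closing a a≮a′) ⟩
        -1ℤ +ℤ excess dyck (suc (toℕ a)) y
          ≤⟨ ℤP.+-mono-≤ (step-≥-1 (w a)) (go (ℕP.≤-trans x≤s (ℕP.n≤1+n _)) s<y
                                               (recurse (ℕP.∸-monoʳ-< (ℕP.n<1+n _) s<y))) ⟩
        step (w a) +ℤ excess w (suc (toℕ a)) y
          ≡⟨ excess-uncons w a s<y ⟨
        excess w (toℕ a) y ∎
        where open ℤP.≤-Reasoning

    prefix-dominated : ∀ {x y s} → Closed x y → y ≤ N → x ≤ s → s ≤ y →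
                       excess w x s - excess w x y ≤ℤ excess dyck x s
    prefix-dominated {x} {y} {s} closed y≤N x≤s s≤y = begin
      excess w x s - excess w x y
        ≡⟨ cong (λ e → excess w x s - e) (excess-split w x≤s s≤y) ⟩
      excess w x s - (excess w x s +ℤ excess w s y)
        ≡⟨ solve 2 (λ a b → a :- (a :+ b) := :- b) refl (excess w x s) (excess w s y) ⟩
      - excess w s y
        ≤⟨ ℤP.neg-mono-≤ (suffix-dominated closed y≤N x≤s s≤y) ⟩
      - excess dyck s y
        ≡⟨ ℤP.+-identityˡ (- excess dyck s y) ⟨
      0ℤ - excess dyck s y
        ≡⟨ cong (_- excess dyck s y) (dyck-balanced (ℕP.≤-trans x≤s s≤y) y≤N closed) ⟨
      excess dyck x y - excess dyck s y
        ≡⟨ cong (_- excess dyck s y) (excess-split dyck x≤s s≤y) ⟩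
      (excess dyck x s +ℤ excess dyck s y) - excess dyck s y
        ≡⟨ solve 2 (λ a b → (a :+ b) :- b := a) refl (excess dyck x s) (excess dyck s y) ⟩
      excess dyck x s ∎
      where open ℤP.≤-Reasoning

contradicting-arc⇒Cext≡0 : ∀ n (π : LinkPattern (2 * n)) w a → toℕ a < mate π a →
                           arcExcess π w a %ℕ 3 ≡ 2 → Cext n w π ≡ 0ℤ
contradicting-arc⇒Cext≡0 n π w a a<a′ contradicting-a
  rewrite Equivalence.to T-≡ (any⁺ (contradicting π w)
            (lose (∈-filter⁺ (λ a → toℕ a <? mate π a) (∈-allFin a) a<a′) (fromWitness contradicting-a)))
  = refl

proposition7p1 : (n : ℕ) → 1 ≤ n →
    (π : LinkPattern (2 * n)) (w : Word (2 * n)) →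
    Cext n w π ≢ 0ℤ →
    (i j : Fin (2 * n)) → toℕ i < toℕ j → Induces π i j →
    (count1 w (toℕ i) (toℕ j + 1) ≤ℤ count0 w (toℕ i) (toℕ j + 1))
    × (∀ t → t ≤ toℕ j ∸ toℕ i + 1 →
         wordHeight w i t - wordHeight w i (toℕ j ∸ toℕ i + 1) ≤ℤ linkHeight π i t)
proposition7p1 n _ π w Cext≢0 i j i<j induces = ones≤zeros , heights
  where
  no-contradicting = λ a a<a′ contradicting-a →
    Cext≢0 (contradicting-arc⇒Cext≡0 n π w a a<a′ contradicting-a)
  closed = induces⇒closed π induces
  i≤j+1 = ℕP.m≤n⇒m≤n+o 1 (ℕP.<⇒≤ i<j)
  j+1≤2n = subst (_≤ 2 * n) (ℕP.+-comm 1 (toℕ j)) (FP.toℕ<n j)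
  ones≤zeros =
    let m , balanced = word-balanced π w no-contradicting i≤j+1 j+1≤2n closed
    in ℤP.0≤i-j⇒j≤i (subst (0ℤ ≤ℤ_) (sym balanced) (+≤+ z≤n))
  i+length≡j+1 : toℕ i + (toℕ j ∸ toℕ i + 1) ≡ toℕ j + 1
  i+length≡j+1 = trans (sym (ℕP.+-assoc (toℕ i) _ 1)) (cong (_+ 1) (ℕP.m+[n∸m]≡n (ℕP.<⇒≤ i<j)))
  heights : ∀ t → t ≤ toℕ j ∸ toℕ i + 1 →
            wordHeight w i t - wordHeight w i (toℕ j ∸ toℕ i + 1) ≤ℤ linkHeight π i t
  heights t t≤length rewrite i+length≡j+1 =
    prefix-dominated π w no-contradicting closed j+1≤2n (ℕP.m≤m+n (toℕ i) t)
      (subst (toℕ i + t ≤_) i+length≡j+1 (ℕP.+-monoʳ-≤ (toℕ i) t≤length))
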